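{- Let $q$ be a prime power, $E=\mathbb{F}_q^n$, and $1<k_1<k_2<n$ with $k_1+k_2\ge n$. Let $\mathcal{M}_1=\mathcal{U}_{k_1,n}(q)$ and $\mathcal{M}_2=\mathcal{U}_{k_2,n}(q)$. Let $a,\mu$ be integers with $a\ge1$, $\mu\ge2$, let $\lambda=\frac{a}{\mu}$ with $0<\lambda<1$, and let $\mathcal{M}=(1-\lambda)\mathcal{M}_1+\lambda\mathcal{M}_2$. Then $\mathcal{I}_\mu(\mathcal{M})=\mathcal{L}(E)$.
   Context: $\mathcal{L}(E)$ is the lattice of subspaces of $E$. The uniform $q$-matroid $\mathcal{U}_{k,n}(q)$ has rank function $\rho(V)=\min\{k,\dim V\}$. $(1-\lambda)\mathcal{M}_1+\lambda\mathcal{M}_2$ is the $q$-polymatroid with rank function $(1-\lambda)\rho_1+\lambda\rho_2$. A space $I$ is $\mu$-independent if $\rho(J)\ge\dim(J)/\mu$ for all $J\le I$; $\mathcal{I}_\mu(\mathcal{M})$ is the set of $\mu$-independent spaces. -}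

module Defs where

open import Level using (0ℓ)
open import Data.Nat as ℕ using (ℕ; zero; suc; _^_; _≤_; _⊓_)
open import Data.Nat.Primality using (Prime)
open import Data.Fin using (Fin; zero; suc)
open import Data.Product using (Σ; ∃; _×_)
open import Data.Integer using (+_)
open import Data.Rational as ℚ using (ℚ; 1ℚ)
open import Relation.Nullary using (¬_)
open import Relation.Binary.PropositionalEquality as ≡ using (_≡_)
open import Algebra.Bundles using (CommutativeRing)
open import Function.Bundles using (Inverse)

record Field : Set₁ where
  field
    commRing : CommutativeRing 0ℓ 0ℓ
  open CommutativeRing commRing public
  field
    0≉1     : ¬ (0# ≈ 1#)
    inverse : ∀ x → ¬ (x ≈ 0#) → Σ Carrier λ y → x * y ≈ 1#

record FiniteField (q : ℕ) : Set₁ where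
  field
    field′ : Field
  open Field field′ public
  field
    card : Inverse setoid (≡.setoid (Fin q))

IsPrimePower : ℕ → Set
IsPrimePower q = ∃ λ p → ∃ λ k → Prime p × 1 ≤ k × q ≡ p ^ k

module Space {q : ℕ} (F : FiniteField q) (n : ℕ) where
  open FiniteField F using (Carrier; _≈_; _+_; _*_; 0#)

  Vect : Set
  Vect = Fin n → Carrier

  _≈ᵥ_ : Vect → Vect → Set
  u ≈ᵥ v = ∀ j → u j ≈ v j

  0ᵥ : Vect
  0ᵥ _ = 0#

  sumF : ∀ {d} → (Fin d → Carrier) → Carrier
  sumF {zero}  f = 0#
  sumF {suc d} f = f zero + sumF (λ i → f (suc i))

  lincomb : ∀ {d} → (Fin d → Carrier) → (Fin d → Vect) → Vect
  lincomb c b j = sumF (λ i → c i * b i j)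

  LinIndep : ∀ {d} → (Fin d → Vect) → Set
  LinIndep b = ∀ c → lincomb c b ≈ᵥ 0ᵥ → ∀ i → c i ≈ 0#

  -- A subspace of E, presented by a basis (every subspace of F_q^n has one).
  record Subspace : Set where
    field
      dim   : ℕ
      basis : Fin dim → Vect
      indep : LinIndep basis

  open Subspace public

  _∈_ : Vect → Subspace → Set
  v ∈ V = Σ (Fin (dim V) → Carrier) λ c → lincomb c (basis V) ≈ᵥ v

  _≤ₛ_ : Subspace → Subspace → Set
  J ≤ₛ I = ∀ v → v ∈ J → v ∈ I

  uniformRank : ℕ → Subspace → ℕ
  uniformRank k V = k ⊓ dim V

  combine : ℚ → (Subspace → ℕ) → (Subspace → ℕ) → Subspace → ℚ
  combine λ′ ρ₁ ρ₂ V =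
    (1ℚ ℚ.- λ′) ℚ.* (+ ρ₁ V ℚ./ 1) ℚ.+ λ′ ℚ.* (+ ρ₂ V ℚ./ 1)

  μIndependent : (μ : ℕ) → .{{_ : ℕ.NonZero μ}} → (Subspace → ℚ) → Subspace → Set
  μIndependent μ ρ I = ∀ J → J ≤ₛ I → (+ dim J) ℚ./ μ ℚ.≤ ρ J

{-# OPTIONS --safe #-}
-- For a subspace J of dimension d, μ ρ(J) = (μ − a) min(k₁, d) + a min(k₂, d) ≥ min(k₁, d) + min(k₂, d),
-- as 1 ≤ a < μ, and min(k₁, d) + min(k₂, d) ≥ d because d ≤ n ≤ k₁ + k₂. That d ≤ n holds since more
-- than n vectors of F^n are linearly dependent, by Gaussian elimination on the first coordinate.
module Submission where

open import Defs
open import Data.Nat as ℕ using (ℕ; _<_; _≤_; _+_)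
open import Data.Integer using (+_)
open import Data.Rational as ℚ using (0ℚ; 1ℚ)

open import Data.Nat using (zero; suc; _∸_; _⊓_; s<s; NonZero; >-nonZero)
open import Data.Nat.Properties
  using (≤-total; ≤-trans; <⇒≤; m≤m+n; m≤n+m; m≤n*m; +-mono-≤; m<n⇒m<1+n; ≮⇒≥;
         m≤n⇒m⊓n≡m; m≥n⇒m⊓n≡n; m+[n∸m]≡n; m<n⇒0<n∸m)
import Data.Nat.Properties as ℕ
open import Data.Integer as ℤ using (+≤+)
import Data.Integer.Properties as ℤ
import Data.Rational.Properties as ℚ
open import Data.Rational.Unnormalised as ℚᵘ using (ℚᵘ; 1ℚᵘ; _≃_; *≡*; *≤*)
import Data.Rational.Unnormalised.Properties as ℚᵘ
open import Data.Rational.Unnormalised.Solver using (module +-*-Solver)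
open import Data.Fin using (Fin; zero; suc; punchIn)
open import Data.Fin.Properties using (all?; ¬∀⟶∃¬)
import Data.Fin.Properties as Fin
open import Data.Product using (∃; _×_; _,_)
open import Data.Sum using (inj₁; inj₂)
open import Data.Vec.Functional using (Vector; tail; insertAt)
open import Data.Vec.Functional.Properties using (insertAt-lookup; insertAt-punchIn)
open import Function using (_∘_)
open import Function.Properties.Inverse using (Inverse⇒Injection)
open import Relation.Binary.Definitions using (Decidable)
open import Relation.Binary.PropositionalEquality as ≡ using (_≡_)
open import Relation.Nullary using (¬_; yes; no)
open import Relation.Nullary.Decidable using (via-injection)

module LinearDependence (F : Field) (_≟_ : Decidable (Field._≈_ F)) where
  open Field F hiding (zero) renaming (_+_ to _⊕_)
  open import Algebra.Properties.Semiring.Sum semiring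
    using (sum; sum-syntax; sum-remove; ∑-distrib-+; *-distribʳ-sum; sum-cong-≋; sum-replicate-zero)
  open import Relation.Binary.Reasoning.Setoid setoid

  IsRelation : ∀ {d m} → (Fin d → Vector Carrier m) → Vector Carrier d → Set
  IsRelation {d} b c = ∀ j → ∑[ i < d ] (c i * b i j) ≈ 0#

  Dependent : ∀ {d m} → (Fin d → Vector Carrier m) → Set
  Dependent b = ∃ λ c → IsRelation b c × ∃ λ i → ¬ c i ≈ 0#

  sum-zero : ∀ {d} {f : Vector Carrier d} → (∀ i → f i ≈ 0#) → sum f ≈ 0#
  sum-zero {d} f≈0 = trans (sum-cong-≋ f≈0) (sum-replicate-zero d)

  IsRelation-tail : ∀ {d m} (b : Fin d → Vector Carrier (suc m)) c →
    (∀ i → b i zero ≈ 0#) → IsRelation (tail ∘ b) c → IsRelation b c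
  IsRelation-tail b c b₀≈0 rel zero    = sum-zero λ i → trans (*-congˡ (b₀≈0 i)) (zeroʳ (c i))
  IsRelation-tail b c b₀≈0 rel (suc j) = rel j

  addPivotMultiples : ∀ {d m} → (Fin (suc d) → Vector Carrier m) → Fin (suc d) → Vector Carrier d →
    Fin d → Vector Carrier m
  addPivotMultiples b p k i j = b (punchIn p i) j ⊕ k i * b p j

  IsRelation-addPivotMultiples : ∀ {d m} (b : Fin (suc d) → Vector Carrier m) p k c →
    IsRelation (addPivotMultiples b p k) c → IsRelation b (insertAt c p (∑[ i < d ] (c i * k i)))
  IsRelation-addPivotMultiples {d} b p k c rel j = begin
    ∑[ i < suc d ] (c′ i * b i j)
      ≈⟨ sum-remove {i = p} (λ i → c′ i * b i j) ⟩
    c′ p * b p j ⊕ ∑[ i < d ] (c′ (punchIn p i) * b (punchIn p i) j)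
      ≈⟨ +-cong (*-congʳ (reflexive (insertAt-lookup c p s)))
                (sum-cong-≋ λ i → *-congʳ (reflexive (insertAt-punchIn c p s i))) ⟩
    s * b p j ⊕ ∑[ i < d ] (c i * b (punchIn p i) j)
      ≈⟨ +-comm _ _ ⟩
    ∑[ i < d ] (c i * b (punchIn p i) j) ⊕ s * b p j
      ≈⟨ +-congˡ (*-distribʳ-sum (b p j) (λ i → c i * k i)) ⟩
    ∑[ i < d ] (c i * b (punchIn p i) j) ⊕ ∑[ i < d ] (c i * k i * b p j)
      ≈⟨ ∑-distrib-+ (λ i → c i * b (punchIn p i) j) (λ i → c i * k i * b p j) ⟨
    ∑[ i < d ] (c i * b (punchIn p i) j ⊕ c i * k i * b p j)
      ≈⟨ sum-cong-≋ (λ i → trans (+-congˡ (*-assoc (c i) (k i) (b p j)))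
                                 (sym (distribˡ (c i) (b (punchIn p i) j) (k i * b p j)))) ⟩
    ∑[ i < d ] (c i * addPivotMultiples b p k i j)
      ≈⟨ rel j ⟩
    0# ∎
    where
    s : Carrier
    s = ∑[ i < d ] (c i * k i)
    c′ : Vector Carrier (suc d)
    c′ = insertAt c p s

  addPivotMultiples-clears : ∀ {d m} (b : Fin (suc d) → Vector Carrier (suc m)) p {y} →
    y * b p zero ≈ 1# → ∀ i → addPivotMultiples b p (λ i → - b (punchIn p i) zero * y) i zero ≈ 0#
  addPivotMultiples-clears b p {y} y*pivot≈1 i = begin
    x ⊕ - x * y * b p zero  ≈⟨ +-congˡ (*-assoc (- x) y (b p zero)) ⟩
    x ⊕ - x * (y * b p zero) ≈⟨ +-congˡ (*-congˡ y*pivot≈1) ⟩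
    x ⊕ - x * 1#            ≈⟨ +-congˡ (*-identityʳ (- x)) ⟩
    x - x                   ≈⟨ -‿inverseʳ x ⟩
    0#                      ∎
    where
    x : Carrier
    x = b (punchIn p i) zero

  m<d⇒dependent : ∀ {m d} → m < d → (b : Fin d → Vector Carrier m) → Dependent b
  m<d⇒dependent {zero} {suc _} _ _ = (λ _ → 1#) , (λ ()) , zero , λ 1≈0 → 0≉1 (sym 1≈0)
  m<d⇒dependent {suc m} {suc d} (s<s m<d) b with all? (λ i → b i zero ≟ 0#)
  ... | yes b₀≈0 =
    let c , rel , nontrivial = m<d⇒dependent (m<n⇒m<1+n m<d) (tail ∘ b)
    in  c , IsRelation-tail b c b₀≈0 rel , nontrivial
  ... | no b₀≉0 =
    let p , pivot≉0 = ¬∀⟶∃¬ _ _ (λ i → b i zero ≟ 0#) b₀≉0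
        y , pivot*y≈1 = inverse (b p zero) pivot≉0
        k : Vector Carrier d
        k i = - b (punchIn p i) zero * y
        b′₀≈0 = addPivotMultiples-clears b p (trans (*-comm y (b p zero)) pivot*y≈1)
        c , rel , i , cᵢ≉0 = m<d⇒dependent m<d (tail ∘ addPivotMultiples b p k)
    in  insertAt c p _
      , IsRelation-addPivotMultiples b p k c (IsRelation-tail (addPivotMultiples b p k) c b′₀≈0 rel)
      , punchIn p i , cᵢ≉0 ∘ trans (sym (reflexive (insertAt-punchIn c p _ i)))

FiniteField-≟ : ∀ {q} (F : FiniteField q) → Decidable (FiniteField._≈_ F)
FiniteField-≟ F = via-injection (Inverse⇒Injection (FiniteField.card F)) Fin._≟_

module _ {q} (F : FiniteField q) (n : ℕ) where
  open Space F n
  open FiniteField F using (field′; Carrier; semiring; _*_; trans; reflexive) renaming (_+_ to _⊕_)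
  open LinearDependence field′ (FiniteField-≟ F)
  open import Algebra.Properties.Semiring.Sum semiring using (sum)

  sumF≡sum : ∀ {d} (f : Fin d → Carrier) → sumF f ≡ sum f
  sumF≡sum {zero}  f = ≡.refl
  sumF≡sum {suc d} f = ≡.cong (f zero ⊕_) (sumF≡sum (tail f))

  LinIndep⇒≤ : ∀ {d} {b : Fin d → Vect} → LinIndep b → d ≤ n
  LinIndep⇒≤ {b = b} independent = ≮⇒≥ λ n<d →
    let c , rel , i , cᵢ≉0 = m<d⇒dependent n<d b
    in  cᵢ≉0 (independent c (λ j → trans (reflexive (sumF≡sum (λ i → c i * b i j))) (rel j)) i)

≤⊓+⊓ : ∀ {d} k₁ k₂ → d ≤ k₁ + k₂ → d ≤ k₁ ⊓ d + k₂ ⊓ d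
≤⊓+⊓ {d} k₁ k₂ d≤k₁+k₂ with ≤-total d k₁ | ≤-total d k₂
... | inj₁ d≤k₁ | _ rewrite m≥n⇒m⊓n≡n d≤k₁ = m≤m+n d (k₂ ⊓ d)
... | inj₂ _ | inj₁ d≤k₂ rewrite m≥n⇒m⊓n≡n d≤k₂ = m≤n+m d (k₁ ⊓ d)
... | inj₂ k₁≤d | inj₂ k₂≤d rewrite m≤n⇒m⊓n≡m k₁≤d | m≤n⇒m⊓n≡m k₂≤d = d≤k₁+k₂

≤*⊓+*⊓ : ∀ {d} a b k₁ k₂ .{{_ : NonZero a}} .{{_ : NonZero b}} →
  d ≤ k₁ + k₂ → d ≤ b ℕ.* (k₁ ⊓ d) + a ℕ.* (k₂ ⊓ d)
≤*⊓+*⊓ {d} a b k₁ k₂ d≤k₁+k₂ =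
  ≤-trans (≤⊓+⊓ k₁ k₂ d≤k₁+k₂) (+-mono-≤ (m≤n*m (k₁ ⊓ d) b) (m≤n*m (k₂ ⊓ d) a))

-- ℚ's _/_ normalises by a gcd, so the arithmetic is done in ℚᵘ, where + n / suc k is mkℚᵘ (+ n) k.
ι : ℕ → ℚᵘ
ι n = + n ℚᵘ./ 1

ι-+ : ∀ m n → ι (m + n) ≃ ι m ℚᵘ.+ ι n
ι-+ m n = *≡* (≡.cong (ℤ._* + 1) (≡.trans (ℤ.pos-+ m n)
  (≡.sym (≡.cong₂ ℤ._+_ (ℤ.*-identityʳ (+ m)) (ℤ.*-identityʳ (+ n))))))

ι-* : ∀ m n → ι (m ℕ.* n) ≃ ι m ℚᵘ.* ι n
ι-* m n = *≡* (≡.cong (ℤ._* + 1) (ℤ.pos-* m n))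

ι-mono-≤ : ∀ {m n} → m ≤ n → ι m ℚᵘ.≤ ι n
ι-mono-≤ m≤n = *≤* (ℤ.*-monoʳ-≤-nonNeg (+ 1) (+≤+ m≤n))

ι[μ]*[n/μ]≃ι[n] : ∀ n k → ι (suc k) ℚᵘ.* (+ n ℚᵘ./ suc k) ≃ ι n
ι[μ]*[n/μ]≃ι[n] n k = *≡* (≡.trans (ℤ.*-identityʳ (+ suc k ℤ.* + n))
  (≡.trans (ℤ.*-comm (+ suc k) (+ n)) (≡.cong (λ m → + n ℤ.* + m) (≡.sym (ℕ.*-identityˡ (suc k))))))

module _ {a b k : ℕ} (a+b≡μ : a + b ≡ suc k) where
  μ : ℚᵘ
  μ = ι (suc k)

  λ′ : ℚᵘ
  λ′ = + a ℚᵘ./ suc k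

  μ*convex≃ι[bx+ay] : ∀ x y → μ ℚᵘ.* ((1ℚᵘ ℚᵘ.- λ′) ℚᵘ.* ι x ℚᵘ.+ λ′ ℚᵘ.* ι y) ≃ ι (b ℕ.* x + a ℕ.* y)
  μ*convex≃ι[bx+ay] x y = begin
    μ ℚᵘ.* ((1ℚᵘ ℚᵘ.- λ′) ℚᵘ.* ι x ℚᵘ.+ λ′ ℚᵘ.* ι y)
      ≈⟨ expand μ λ′ (ι x) (ι y) ⟩
    μ ℚᵘ.* ι x ℚᵘ.- μ ℚᵘ.* λ′ ℚᵘ.* ι x ℚᵘ.+ μ ℚᵘ.* λ′ ℚᵘ.* ι y
      ≈⟨ ℚᵘ.+-cong (ℚᵘ.+-cong (ℚᵘ.*-congʳ μ≃a+b) (ℚᵘ.-‿cong (ℚᵘ.*-congʳ μλ≃a))) (ℚᵘ.*-congʳ μλ≃a) ⟩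
    (ι a ℚᵘ.+ ι b) ℚᵘ.* ι x ℚᵘ.- ι a ℚᵘ.* ι x ℚᵘ.+ ι a ℚᵘ.* ι y
      ≈⟨ collect (ι a) (ι b) (ι x) (ι y) ⟩
    ι b ℚᵘ.* ι x ℚᵘ.+ ι a ℚᵘ.* ι y
      ≈⟨ ℚᵘ.+-cong (ι-* b x) (ι-* a y) ⟨
    ι (b ℕ.* x) ℚᵘ.+ ι (a ℕ.* y)
      ≈⟨ ι-+ (b ℕ.* x) (a ℕ.* y) ⟨
    ι (b ℕ.* x + a ℕ.* y) ∎
    where
    open ℚᵘ.≃-Reasoning
    open +-*-Solver
    μ≃a+b : μ ≃ ι a ℚᵘ.+ ι b
    μ≃a+b = ℚᵘ.≃-trans (ℚᵘ.≃-reflexive (≡.cong ι (≡.sym a+b≡μ))) (ι-+ a b)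
    μλ≃a : μ ℚᵘ.* λ′ ≃ ι a
    μλ≃a = ι[μ]*[n/μ]≃ι[n] a k
    expand : ∀ m l x y → m ℚᵘ.* ((1ℚᵘ ℚᵘ.- l) ℚᵘ.* x ℚᵘ.+ l ℚᵘ.* y)
                       ≃ m ℚᵘ.* x ℚᵘ.- m ℚᵘ.* l ℚᵘ.* x ℚᵘ.+ m ℚᵘ.* l ℚᵘ.* y
    expand = solve 4 (λ m l x y → m :* ((con 1ℚᵘ :- l) :* x :+ l :* y)
                                := m :* x :- m :* l :* x :+ m :* l :* y) ℚᵘ.≃-refl
    collect : ∀ a b x y → (a ℚᵘ.+ b) ℚᵘ.* x ℚᵘ.- a ℚᵘ.* x ℚᵘ.+ a ℚᵘ.* y ≃ b ℚᵘ.* x ℚᵘ.+ a ℚᵘ.* y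
    collect = solve 4 (λ a b x y → (a :+ b) :* x :- a :* x :+ a :* y := b :* x :+ a :* y) ℚᵘ.≃-refl

  convex-boundᵘ : ∀ {d} x y → d ≤ b ℕ.* x + a ℕ.* y →
    + d ℚᵘ./ suc k ℚᵘ.≤ (1ℚᵘ ℚᵘ.- λ′) ℚᵘ.* ι x ℚᵘ.+ λ′ ℚᵘ.* ι y
  convex-boundᵘ {d} x y d≤bx+ay = ℚᵘ.*-cancelˡ-≤-pos μ
    (ℚᵘ.≤-respˡ-≃ (ℚᵘ.≃-sym (ι[μ]*[n/μ]≃ι[n] d k))
      (ℚᵘ.≤-respʳ-≃ (ℚᵘ.≃-sym (μ*convex≃ι[bx+ay] x y)) (ι-mono-≤ d≤bx+ay)))

toℚᵘ-convex : ∀ {p q r p′ q′ r′} → ℚ.toℚᵘ p ≃ p′ → ℚ.toℚᵘ q ≃ q′ → ℚ.toℚᵘ r ≃ r′ →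
  ℚ.toℚᵘ ((1ℚ ℚ.- p) ℚ.* q ℚ.+ p ℚ.* r) ≃ (1ℚᵘ ℚᵘ.- p′) ℚᵘ.* q′ ℚᵘ.+ p′ ℚᵘ.* r′
toℚᵘ-convex {p} {q} {r} {p′} {q′} {r′} p≃p′ q≃q′ r≃r′ = begin
  ℚ.toℚᵘ ((1ℚ ℚ.- p) ℚ.* q ℚ.+ p ℚ.* r)
    ≈⟨ ℚ.toℚᵘ-homo-+ ((1ℚ ℚ.- p) ℚ.* q) (p ℚ.* r) ⟩
  ℚ.toℚᵘ ((1ℚ ℚ.- p) ℚ.* q) ℚᵘ.+ ℚ.toℚᵘ (p ℚ.* r)
    ≈⟨ ℚᵘ.+-cong (ℚ.toℚᵘ-homo-* (1ℚ ℚ.- p) q) (ℚ.toℚᵘ-homo-* p r) ⟩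
  ℚ.toℚᵘ (1ℚ ℚ.- p) ℚᵘ.* ℚ.toℚᵘ q ℚᵘ.+ ℚ.toℚᵘ p ℚᵘ.* ℚ.toℚᵘ r
    ≈⟨ ℚᵘ.+-cong (ℚᵘ.*-cong (ℚ.toℚᵘ-homo-+ 1ℚ (ℚ.- p)) q≃q′) (ℚᵘ.*-cong p≃p′ r≃r′) ⟩
  (ℚ.toℚᵘ 1ℚ ℚᵘ.+ ℚ.toℚᵘ (ℚ.- p)) ℚᵘ.* q′ ℚᵘ.+ p′ ℚᵘ.* r′
    ≈⟨ ℚᵘ.+-congˡ (p′ ℚᵘ.* r′)
         (ℚᵘ.*-congʳ (ℚᵘ.+-congʳ (ℚ.toℚᵘ 1ℚ) (ℚᵘ.≃-trans (ℚ.toℚᵘ-homo‿- p) (ℚᵘ.-‿cong p≃p′)))) ⟩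
  (1ℚᵘ ℚᵘ.- p′) ℚᵘ.* q′ ℚᵘ.+ p′ ℚᵘ.* r′ ∎
  where open ℚᵘ.≃-Reasoning

toℚᵘ-/ : ∀ n k → ℚ.toℚᵘ (+ n ℚ./ suc k) ≃ + n ℚᵘ./ suc k
toℚᵘ-/ n k = ℚ.toℚᵘ-fromℚᵘ (+ n ℚᵘ./ suc k)

convex-bound : ∀ a b {k d} → a + b ≡ suc k → ∀ x y → d ≤ b ℕ.* x + a ℕ.* y →
  + d ℚ./ suc k ℚ.≤ (1ℚ ℚ.- + a ℚ./ suc k) ℚ.* (+ x ℚ./ 1) ℚ.+ (+ a ℚ./ suc k) ℚ.* (+ y ℚ./ 1)
convex-bound a b {k} {d} a+b≡μ x y d≤bx+ay = ℚ.toℚᵘ-cancel-≤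
  (ℚᵘ.≤-respˡ-≃ (ℚᵘ.≃-sym (toℚᵘ-/ d k))
    (ℚᵘ.≤-respʳ-≃ (ℚᵘ.≃-sym (toℚᵘ-convex (toℚᵘ-/ a k) (toℚᵘ-/ x 0) (toℚᵘ-/ y 0)))
      (convex-boundᵘ {a} {b} {k} a+b≡μ x y d≤bx+ay)))

[a/μ]<1⇒a<μ : ∀ {a k} → + a ℚ./ suc k ℚ.< 1ℚ → a < suc k
[a/μ]<1⇒a<μ {a} {k} a/μ<1 =
  ℤ.drop‿+<+ (≡.subst₂ ℤ._<_ (ℤ.*-identityʳ (+ a)) (ℤ.*-identityˡ (+ suc k))
    (ℚᵘ.drop-*<* (ℚᵘ.<-respˡ-≃ (toℚᵘ-/ a k) (ℚ.toℚᵘ-mono-< a/μ<1))))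

theorem6p2 : (q : ℕ) → IsPrimePower q → (F : FiniteField q) → (n k₁ k₂ : ℕ)
    → 1 < k₁ → k₁ < k₂ → k₂ < n → n ≤ k₁ + k₂
    → (a μ : ℕ) → .{{_ : ℕ.NonZero μ}} → 1 ≤ a → 2 ≤ μ
    → 0ℚ ℚ.< (+ a) ℚ./ μ → (+ a) ℚ./ μ ℚ.< 1ℚ
    → let open Space F n in
      (I : Subspace)
    → μIndependent μ (combine ((+ a) ℚ./ μ) (uniformRank k₁) (uniformRank k₂)) I
theorem6p2 q _ F n k₁ k₂ _ _ _ n≤k₁+k₂ a (suc k) 1≤a _ _ a/μ<1 I J _ =
  convex-bound a b (m+[n∸m]≡n (<⇒≤ a<μ)) (k₁ ⊓ d) (k₂ ⊓ d)
    (≤*⊓+*⊓ a b k₁ k₂ {{>-nonZero 1≤a}} {{>-nonZero (m<n⇒0<n∸m a<μ)}} d≤k₁+k₂)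
  where
  open Space F n using (dim; indep)
  d : ℕ
  d = dim J
  a<μ : a < suc k
  a<μ = [a/μ]<1⇒a<μ a/μ<1
  b : ℕ
  b = suc k ∸ a
  d≤k₁+k₂ : d ≤ k₁ + k₂
  d≤k₁+k₂ = ≤-trans (LinIndep⇒≤ F n (indep J)) n≤k₁+k₂
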